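{- Let $r$ be a power of a prime, and let $k$ and $m$ be positive integers satisfying $\frac{r^k-1}{r-1}=\frac{m}{\gcd(m,r-1)}$. Then $\gcd(m,r)=1$ and $k$ is the smallest positive integer such that $r^k\equiv 1 \pmod m$. -}

module Defs where

open import Data.Nat using (ℕ; zero; suc; _+_; _*_; _∸_; _^_; _<_; _/_; NonZero; >-nonZero; ≢-nonZero)
open import Data.Nat.Properties using (m<n⇒0<n∸m)
open import Data.Nat.GCD using (gcd; gcd[m,n]≢0)
open import Data.Nat.Primality using (Prime)
open import Data.Nat.Divisibility using (_∣_)
open import Data.Product using (Σ; _×_)
open import Data.Sum using (inj₁)
open import Relation.Binary.PropositionalEquality using (_≡_)
open import Data.Nat.Properties using (m<n⇒n≢0)

IsPrimePower : ℕ → Set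
IsPrimePower r = Σ ℕ λ p → Σ ℕ λ e → Prime p × 0 < e × r ≡ p ^ e

-- a ≡ b (mod m) on naturals, as divisibility of the difference.
-- (Only used with b = 1 ≤ a, so the truncated subtraction is harmless.)
infix 4 _≡1[mod_]
_≡1[mod_] : ℕ → ℕ → Set
a ≡1[mod m ] = m ∣ (a ∸ 1)

Hyp : (r k m : ℕ) → 1 < r → 0 < m → Set
Hyp r k m 1<r 0<m =
  ((r ^ k ∸ 1) / (r ∸ 1)) {{nz₁}} ≡ (m / gcd m (r ∸ 1)) {{nz₂}}
  where
  nz₁ : NonZero (r ∸ 1)
  nz₁ = >-nonZero (m<n⇒0<n∸m 1<r)
  nz₂ : NonZero (gcd m (r ∸ 1))
  nz₂ = ≢-nonZero (gcd[m,n]≢0 m (r ∸ 1) (inj₁ (m<n⇒n≢0 0<m)))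

{-# OPTIONS --safe #-}

-- Write r = 1 + s. The left side of the hypothesis is the repunit
-- R = 1 + r + ⋯ + r^(k-1), so m = g R with g = gcd(m, s). Since g ∣ s = r − 1
-- and R ≡ 1 (mod r), both factors are coprime to r, and m = g R divides
-- s R = r^k − 1. If m ∣ r^j − 1 with j > 0, then R ≤ r^j − 1 < R_(j+1),
-- which forces k ≤ j.
module Submission where

open import Defs
open import Data.Nat using (ℕ; zero; suc; _+_; _*_; _∸_; _^_; _/_; _≤_; _<_; _≤′_; ≤′-refl; ≤′-step; z≤n; s≤s; s≤s⁻¹; NonZero; >-nonZero; >-nonZero⁻¹; ≢-nonZero)
open import Data.Nat.Properties
open import Data.Nat.Tactic.RingSolver using (solve-∀)
open import Data.Nat.GCD using (gcd; gcd[m,n]∣m; gcd[m,n]∣n; gcd[m,n]≢0)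
open import Data.Nat.Coprimality using (Coprime; coprime⇒gcd≡1; coprime-divisor)
open import Data.Nat.Divisibility using (_∣_; ∣-trans; ∣1⇒≡1; ∣m+n∣m⇒∣n; ∣m⇒∣m*n; n∣m*n; *-monoˡ-∣; ∣⇒≤)
open import Data.Nat.DivMod using (m*n/n≡m; m*[n/m]≡n)
open import Data.Product using (_×_; _,_)
open import Data.Sum using (inj₁)
open import Function using (_∘′_)
open import Relation.Nullary using (yes; no; contradiction)
open import Relation.Binary.PropositionalEquality using (_≡_; sym; cong; subst; subst₂; module ≡-Reasoning)

coprime-* : ∀ {a b c} → Coprime a c → Coprime b c → Coprime (a * b) c
coprime-* {a} {b} {c} a⊥c b⊥c {d} (d∣ab , d∣c) = b⊥c (coprime-divisor d⊥a d∣ab , d∣c)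
  where
  d⊥a : Coprime d a
  d⊥a (e∣d , e∣a) = a⊥c (e∣a , ∣-trans e∣d d∣c)

∣n⇒coprime-suc : ∀ {d n} → d ∣ n → Coprime d (suc n)
∣n⇒coprime-suc {n = n} d∣n {e} (e∣d , e∣1+n) =
  ∣1⇒≡1 (∣m+n∣m⇒∣n (subst (e ∣_) (+-comm 1 n) e∣1+n) (∣-trans e∣d d∣n))

repunit : ℕ → ℕ → ℕ
repunit b zero    = 0
repunit b (suc k) = b * repunit b k + 1

repunit-suc>0 : ∀ b k → 0 < repunit b (suc k)
repunit-suc>0 b k = m≤n+m 1 (b * repunit b k)

repunit-suc-coprime : ∀ b k → Coprime (repunit b (suc k)) b
repunit-suc-coprime b k (d∣R , d∣b) = ∣1⇒≡1 (∣m+n∣m⇒∣n d∣R (∣m⇒∣m*n (repunit b k) d∣b))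

module _ (s : ℕ) where

  [1+s]^k≡1+s*repunit : ∀ k → suc s ^ k ≡ 1 + s * repunit (suc s) k
  [1+s]^k≡1+s*repunit zero    = cong suc (sym (*-zeroʳ s))
  [1+s]^k≡1+s*repunit (suc k) = begin
    suc s * suc s ^ k                   ≡⟨ cong (suc s *_) ([1+s]^k≡1+s*repunit k) ⟩
    suc s * (1 + s * repunit (suc s) k) ≡⟨ expand s (repunit (suc s) k) ⟩
    1 + s * repunit (suc s) (suc k)     ∎
    where
    open ≡-Reasoning
    expand : ∀ a x → suc a * (1 + a * x) ≡ 1 + a * (suc a * x + 1)
    expand = solve-∀

  [1+s]^k∸1≡s*repunit : ∀ k → suc s ^ k ∸ 1 ≡ s * repunit (suc s) k
  [1+s]^k∸1≡s*repunit k = cong (_∸ 1) ([1+s]^k≡1+s*repunit k)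

  [1+s]^k≤repunit-suc : ∀ k → suc s ^ k ≤ repunit (suc s) (suc k)
  [1+s]^k≤repunit-suc zero    = m≤n+m 1 (s * 0)
  [1+s]^k≤repunit-suc (suc k) = ≤-trans (*-monoʳ-≤ (suc s) ([1+s]^k≤repunit-suc k)) (m≤m+n _ 1)

  repunit-mono-≤ : ∀ {a b} → a ≤ b → repunit (suc s) a ≤ repunit (suc s) b
  repunit-mono-≤ = mono′ ∘′ ≤⇒≤′
    where
    mono′ : ∀ {a b} → a ≤′ b → repunit (suc s) a ≤ repunit (suc s) b
    mono′ ≤′-refl               = ≤-refl
    mono′ (≤′-step {n} a≤′n) =
      ≤-trans (mono′ a≤′n) (≤-trans (m≤n*m (repunit (suc s) n) (suc s)) (m≤m+n _ 1))

  repunit-cancel-< : ∀ {a b} → repunit (suc s) a < repunit (suc s) b → a < b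
  repunit-cancel-< {a} {b} Ra<Rb with a <? b
  ... | yes a<b = a<b
  ... | no  a≮b = contradiction (repunit-mono-≤ (≮⇒≥ a≮b)) (<⇒≱ Ra<Rb)

  [1+s]^k∸1/s≡repunit : ∀ k .{{_ : NonZero s}} → (suc s ^ k ∸ 1) / s ≡ repunit (suc s) k
  [1+s]^k∸1/s≡repunit k = begin
    (suc s ^ k ∸ 1) / s       ≡⟨ cong (_/ s) ([1+s]^k∸1≡s*repunit k) ⟩
    s * repunit (suc s) k / s ≡⟨ cong (_/ s) (*-comm s _) ⟩
    repunit (suc s) k * s / s ≡⟨ m*n/n≡m _ s ⟩
    repunit (suc s) k         ∎
    where
    open ≡-Reasoning

  repunit∣[1+s]^j∸1⇒k≤j : ∀ {k j} .{{_ : NonZero s}} → 0 < j →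
                         repunit (suc s) k ∣ suc s ^ j ∸ 1 → k ≤ j
  repunit∣[1+s]^j∸1⇒k≤j {k} {suc j} _ Rₖ∣ = s≤s⁻¹ (repunit-cancel-< (begin-strict
    repunit (suc s) k               ≤⟨ ∣⇒≤ {{>-nonZero 0<s*Rⱼ}} Rₖ∣s*Rⱼ ⟩
    s * repunit (suc s) (suc j)     <⟨ n<1+n _ ⟩
    1 + s * repunit (suc s) (suc j) ≡⟨ sym ([1+s]^k≡1+s*repunit (suc j)) ⟩
    suc s ^ suc j                   ≤⟨ [1+s]^k≤repunit-suc (suc j) ⟩
    repunit (suc s) (suc (suc j))   ∎))
    where
    open ≤-Reasoning
    Rₖ∣s*Rⱼ : repunit (suc s) k ∣ s * repunit (suc s) (suc j)
    Rₖ∣s*Rⱼ = subst (repunit (suc s) k ∣_) ([1+s]^k∸1≡s*repunit (suc j)) Rₖ∣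
    0<s*Rⱼ : 0 < s * repunit (suc s) (suc j)
    0<s*Rⱼ = *-mono-< (>-nonZero⁻¹ s) (repunit-suc>0 (suc s) j)

lemma4p1 : (r k m : ℕ) → IsPrimePower r → (1<r : 1 < r) → (0<k : 0 < k) → (0<m : 0 < m) →
           Hyp r k m 1<r 0<m →
           gcd m r ≡ 1
           × (0 < k × r ^ k ≡1[mod m ] × (∀ j → 0 < j → r ^ j ≡1[mod m ] → k ≤ j))
lemma4p1 (suc s@(suc _)) k@(suc k′) m _ (s≤s (s≤s z≤n)) 0<k 0<m hyp =
  coprime⇒gcd≡1 m⊥r , 0<k , m∣rᵏ∸1 , minimal
  where
  g = gcd m s
  R = repunit (suc s) k
  instance
    g≢0 : NonZero g
    g≢0 = ≢-nonZero (gcd[m,n]≢0 m s (inj₁ (m<n⇒n≢0 0<m)))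
  m≡g*R : m ≡ g * R
  m≡g*R = begin
    m                         ≡⟨ sym (m*[n/m]≡n (gcd[m,n]∣m m s)) ⟩
    g * (m / g)               ≡⟨ cong (g *_) (sym hyp) ⟩
    g * ((suc s ^ k ∸ 1) / s) ≡⟨ cong (g *_) ([1+s]^k∸1/s≡repunit s k) ⟩
    g * R                     ∎
    where
    open ≡-Reasoning
  m⊥r : Coprime m (suc s)
  m⊥r = subst (λ x → Coprime x (suc s)) (sym m≡g*R)
          (coprime-* (∣n⇒coprime-suc (gcd[m,n]∣n m s)) (repunit-suc-coprime (suc s) k′))
  m∣rᵏ∸1 : m ∣ suc s ^ k ∸ 1
  m∣rᵏ∸1 = subst₂ _∣_ (sym m≡g*R) (sym ([1+s]^k∸1≡s*repunit s k)) (*-monoˡ-∣ R (gcd[m,n]∣n m s))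
  minimal : ∀ j → 0 < j → suc s ^ j ≡1[mod m ] → k ≤ j
  minimal j 0<j m∣ = repunit∣[1+s]^j∸1⇒k≤j s 0<j (∣-trans (subst (R ∣_) (sym m≡g*R) (n∣m*n g)) m∣)
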